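{- Let $n=\prod_{i=1}^k p_i^{\alpha_i}$ be the prime factorization of an integer $n>1$ with $\alpha_i>0$ for all $i$, and let $a\in GP(\mathbb Z_n)\setminus P(\mathbb Z_n)$. Then $a_l=b^{\varphi(n/b)}$ (computed in $\mathbb Z_n$), where $b=\prod_{j:\ a\not\equiv 1 \pmod{p_j^{\alpha_j}}} p_j^{\alpha_j}$ and $\varphi$ is Euler's totient function.
   Context: On $\mathbb Z_n$ define the partial order $\leq$ by: $a\leq b$ iff $a=b$ or $a\equiv ab\pmod n$; write $a<b$ for $a\leq b$, $a\neq b$. $GP(\mathbb Z_n)$ is the set of $a\in\mathbb Z_n$ with $a^m=a$ for some integer $m\geq2$, and $P(\mathbb Z_n)=\{a: a^2=a\}$. For $a\in GP(\mathbb Z_n)\setminus P(\mathbb Z_n)$, the lower covering projection $a_l$ is the unique element of $GP(\mathbb Z_n)$ that is a lower cover of $a$ in the poset $(GP(\mathbb Z_n),\leq)$; it is known to exist, to be a projection, and to satisfy: for $x\in GP(\mathbb Z_n)$, $x<a$ iff $x\leq a_l$ (i.e. $a_l$ is the greatest element of $\{x\in GP(\mathbb Z_n): x<a\}$). -}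

module Defs where

open import Data.Nat using (ℕ; zero; suc; _+_; _*_; _^_; _≤_; _<_)
open import Data.Nat.DivMod using (_%_; _/_)
open import Data.Nat.GCD using (gcd)
open import Data.Nat.Properties using (_≟_)
open import Data.Fin using (Fin)
import Data.Fin as F
open import Data.List using (List; length; filter; map; upTo)
open import Data.Product using (Σ; _×_)
open import Data.Sum using (_⊎_)
open import Relation.Nullary using (¬_; yes; no)
open import Relation.Binary.PropositionalEquality using (_≡_)

-- reduction modulo n (x mod 0 = x; only used with n > 0)
_mod_ : ℕ → ℕ → ℕ
x mod zero    = x
x mod (suc n) = x % suc n

-- natural-number division (d = 0 gives 0; only used with d > 0)
_div_ : ℕ → ℕ → ℕ
m div zero    = 0
m div (suc d) = m / suc d

φ : ℕ → ℕ
φ m = length (filter (λ i → gcd i m ≟ 1) (map suc (upTo m)))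

∏ : (k : ℕ) → (Fin k → ℕ) → ℕ
∏ zero    f = 1
∏ (suc k) f = f F.zero * ∏ k (λ i → f (F.suc i))

-- Elements of ℤ_n are represented by naturals x < n.
-- Partial order:  a ≤ b  iff  a = b  or  a ≡ a b (mod n)
_≼[_]_ : ℕ → ℕ → ℕ → Set
a ≼[ n ] b = a ≡ b ⊎ a mod n ≡ (a * b) mod n

_≺[_]_ : ℕ → ℕ → ℕ → Set
a ≺[ n ] b = a ≼[ n ] b × ¬ (a ≡ b)

GP : ℕ → ℕ → Set
GP n a = Σ ℕ (λ m → 2 ≤ m × (a ^ m) mod n ≡ a mod n)

P : ℕ → ℕ → Set
P n a = (a * a) mod n ≡ a mod n

LowerCoverGP : ℕ → ℕ → ℕ → Set
LowerCoverGP n x a =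
  x < n × GP n x × x ≺[ n ] a ×
  ((y : ℕ) → y < n → GP n y → x ≺[ n ] y → ¬ (y ≺[ n ] a))

bOf : (k : ℕ) → (Fin k → ℕ) → ℕ → ℕ
bOf k q a = ∏ k (λ j → sel (a mod q j ≟ 1 mod q j) (q j))
  where
  sel : {A : Set} → Relation.Nullary.Dec A → ℕ → ℕ
  sel (yes _) _ = 1
  sel (no _)  r = r

-- By the Chinese remainder theorem, congruences modulo n = ∏ pᵢ^αᵢ are checked componentwise.
-- Every y ∈ GP(ℤ_n) is 0 or a unit modulo each pᵢ^αᵢ. Splitting n = b c with c the product of
-- the pᵢ^αᵢ where a ≡ 1, Euler's theorem for the coprime b and c makes t = b^φ(c) the projection
-- that is 1 where a ≡ 1 and 0 elsewhere. Hence t < a (t ≠ a as a is not a projection), and any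
-- y ∈ GP(ℤ_n) with y = y a vanishes where a ≢ 1 (a unit there would force a ≡ 1), so y ≤ t.
-- Thus t is the greatest element of GP(ℤ_n) strictly below a, hence its unique lower cover.
module Submission where

open import Defs
open import Data.Nat using (ℕ; _^_; _<_)
open import Data.Nat.Primality using (Prime)
open import Data.Fin using (Fin)
open import Function.Definitions using (Injective)
open import Function.Bundles using (_⇔_)
open import Relation.Nullary using (¬_)
open import Relation.Binary.PropositionalEquality using (_≡_)

open import Data.Nat
open import Data.Nat.Properties
open import Data.Nat.DivMod hiding (_mod_; _div_)
open import Data.Nat.Divisibility
open import Data.Nat.Coprimality using (Coprime; coprime-divisor; 1-coprimeTo; 0-coprimeTo-m⇒m≡1; gcd≡1⇒coprime; coprime⇒gcd≡1)
import Data.Nat.Coprimality as Coprime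
open import Data.Nat.Primality using (prime⇒irreducible; prime⇒nonZero; prime⇒nonTrivial)
open import Data.Nat.ListAction using (product)
open import Data.Nat.ListAction.Properties using (product-↭)
open import Data.Nat.GCD using (gcd)
import Data.Fin as Fin
import Data.Fin.Properties as Fin
open import Data.List using (List; []; _∷_; _++_; map; filter; upTo; length)
open import Data.List.Properties using (length-map; length-++)
open import Data.List.Membership.Propositional using (_∈_)
open import Data.List.Membership.Propositional.Properties
open import Data.List.Relation.Unary.Any using (here; there)
import Data.List.Relation.Unary.All as All
open import Data.List.Relation.Unary.All.Properties using () renaming (map⁺ to All-map⁺)
open import Data.List.Relation.Unary.AllPairs using ([]; _∷_)
open import Data.List.Relation.Unary.Unique.Propositional using (Unique)
import Data.List.Relation.Unary.Unique.Propositional.Properties as Unique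
open import Data.List.Relation.Binary.Permutation.Propositional using (_↭_; ↭-refl; ↭-trans; ↭-sym; prep)
open import Data.List.Relation.Binary.Permutation.Propositional.Properties using (shift)
open import Data.Product using (_×_; _,_; proj₁)
open import Data.Sum using (_⊎_; inj₁; inj₂)
open import Function.Bundles using (mk⇔)
open import Function.Base using (_∘_)
open import Relation.Nullary using (Dec; yes; no; contradiction)
open import Relation.Binary.PropositionalEquality using (refl; sym; trans; cong; cong₂; subst; subst₂; _≢_; module ≡-Reasoning)
open import Data.Nat.Tactic.RingSolver using (solve-∀)

-- A record rather than a plain equation, so that the modulus can be inferred.
record _≡_[mod_] (x y m : ℕ) : Set where
  constructor mk≡mod
  field ≡mod⇒mod≡ : x mod m ≡ y mod m
open _≡_[mod_] public

infix 4 _≡_[mod_]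

mod≡% : ∀ x m .{{_ : NonZero m}} → x mod m ≡ x % m
mod≡% x (suc m) = refl

module _ {m : ℕ} .{{_ : NonZero m}} where

  ≡mod⇒%≡ : ∀ {x y} → x ≡ y [mod m ] → x % m ≡ y % m
  ≡mod⇒%≡ {x} {y} (mk≡mod e) = trans (sym (mod≡% x m)) (trans e (mod≡% y m))

  %≡⇒≡mod : ∀ {x y} → x % m ≡ y % m → x ≡ y [mod m ]
  %≡⇒≡mod {x} {y} e = mk≡mod (trans (mod≡% x m) (trans e (sym (mod≡% y m))))

  ≡mod-refl : ∀ {x} → x ≡ x [mod m ]
  ≡mod-refl = mk≡mod refl

  ≡mod-sym : ∀ {x y} → x ≡ y [mod m ] → y ≡ x [mod m ]
  ≡mod-sym (mk≡mod e) = mk≡mod (sym e)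

  ≡mod-trans : ∀ {x y z} → x ≡ y [mod m ] → y ≡ z [mod m ] → x ≡ z [mod m ]
  ≡mod-trans (mk≡mod e) (mk≡mod f) = mk≡mod (trans e f)

  ≡⇒≡mod : ∀ {x y} → x ≡ y → x ≡ y [mod m ]
  ≡⇒≡mod refl = ≡mod-refl

  *-cong-≡mod : ∀ {x x′ y y′} → x ≡ x′ [mod m ] → y ≡ y′ [mod m ] → x * y ≡ x′ * y′ [mod m ]
  *-cong-≡mod {x} {x′} {y} {y′} e f = %≡⇒≡mod (begin
      (x * y) % m                 ≡⟨ %-distribˡ-* x y m ⟩
      ((x % m) * (y % m)) % m     ≡⟨ cong₂ (λ u v → (u * v) % m) (≡mod⇒%≡ e) (≡mod⇒%≡ f) ⟩
      ((x′ % m) * (y′ % m)) % m   ≡⟨ %-distribˡ-* x′ y′ m ⟨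
      (x′ * y′) % m               ∎)
    where open ≡-Reasoning

  *-congˡ-≡mod : ∀ {x y y′} → y ≡ y′ [mod m ] → x * y ≡ x * y′ [mod m ]
  *-congˡ-≡mod {x} = *-cong-≡mod (≡mod-refl {x})

  *-congʳ-≡mod : ∀ {x x′ y} → x ≡ x′ [mod m ] → x * y ≡ x′ * y [mod m ]
  *-congʳ-≡mod {y = y} e = *-cong-≡mod e (≡mod-refl {y})

  mod-≡mod : ∀ x → x mod m ≡ x [mod m ]
  mod-≡mod x = %≡⇒≡mod (trans (cong (_% m) (mod≡% x m)) (m%n%n≡m%n x m))

  mod-< : ∀ x → x mod m < m
  mod-< x = subst (_< m) (sym (mod≡% x m)) (m%n<n x m)

  ∣⇒≡0mod : ∀ {x} → m ∣ x → x ≡ 0 [mod m ]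
  ∣⇒≡0mod {x} m∣x = %≡⇒≡mod (trans (n∣m⇒m%n≡0 x m m∣x) (sym (0%m≡0 m)))
    where 0%m≡0 : ∀ m .{{_ : NonZero m}} → 0 % m ≡ 0
          0%m≡0 (suc _) = refl

  ∣∸⇒≡mod : ∀ {x y} → x ≤ y → m ∣ y ∸ x → x ≡ y [mod m ]
  ∣∸⇒≡mod {x} {y} x≤y (divides k eq) = %≡⇒≡mod (begin
      x % m                ≡⟨ [m+kn]%n≡m%n x k m ⟨
      (x + k * m) % m      ≡⟨ cong (λ u → (x + u) % m) eq ⟨
      (x + (y ∸ x)) % m    ≡⟨ cong (_% m) (m+[n∸m]≡n x≤y) ⟩
      y % m                ∎)
    where open ≡-Reasoning

  ≡mod⇒∣∸ : ∀ {x y} → x ≤ y → x ≡ y [mod m ] → m ∣ y ∸ x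
  ≡mod⇒∣∸ {x} {y} x≤y e = divides (y / m ∸ x / m) (begin
      y ∸ x                                        ≡⟨ cong₂ _∸_ (m≡m%n+[m/n]*n y m) (m≡m%n+[m/n]*n x m) ⟩
      (y % m + y / m * m) ∸ (x % m + x / m * m)    ≡⟨ cong (λ u → (y % m + y / m * m) ∸ (u + x / m * m)) (≡mod⇒%≡ e) ⟩
      (y % m + y / m * m) ∸ (y % m + x / m * m)    ≡⟨ [m+n]∸[m+o]≡n∸o (y % m) (y / m * m) (x / m * m) ⟩
      y / m * m ∸ x / m * m                        ≡⟨ *-distribʳ-∸ m (y / m) (x / m) ⟨
      (y / m ∸ x / m) * m                          ∎)
    where open ≡-Reasoning

  ≡mod-residue : ∀ {x y} → x < m → y < m → x ≡ y [mod m ] → x ≡ y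
  ≡mod-residue x<m y<m e = trans (sym (m<n⇒m%n≡m x<m)) (trans (≡mod⇒%≡ e) (m<n⇒m%n≡m y<m))

  ≡0-absorbs : ∀ {u v} → u ≡ 0 [mod m ] → u ≡ u * v [mod m ]
  ≡0-absorbs {v = v} u≡0 = ≡mod-trans u≡0 (≡mod-sym (*-congʳ-≡mod {y = v} u≡0))

  ≡1-neutral : ∀ {u v} → v ≡ 1 [mod m ] → u ≡ u * v [mod m ]
  ≡1-neutral {u} v≡1 = ≡mod-sym (≡mod-trans (*-congˡ-≡mod {u} v≡1) (≡⇒≡mod (*-identityʳ u)))

  private
    cancel-≤ : ∀ {c x y} → Coprime m c → x ≤ y → c * x ≡ c * y [mod m ] → x ≡ y [mod m ]
    cancel-≤ {c} {x} {y} m⊥c x≤y cx≡cy = ∣∸⇒≡mod x≤y (coprime-divisor m⊥c m∣c[y∸x])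
      where
      m∣c[y∸x] : m ∣ c * (y ∸ x)
      m∣c[y∸x] = subst (m ∣_) (sym (*-distribˡ-∸ c y x)) (≡mod⇒∣∸ (*-monoʳ-≤ c x≤y) cx≡cy)

  ≡mod-cancelˡ : ∀ {c x y} → Coprime m c → c * x ≡ c * y [mod m ] → x ≡ y [mod m ]
  ≡mod-cancelˡ {c} {x} {y} m⊥c cx≡cy with ≤-total x y
  ... | inj₁ x≤y = cancel-≤ m⊥c x≤y cx≡cy
  ... | inj₂ y≤x = ≡mod-sym (cancel-≤ m⊥c y≤x (≡mod-sym cx≡cy))

  ≡mod-cancelʳ : ∀ {c x y} → Coprime m c → x * c ≡ y * c [mod m ] → x ≡ y [mod m ]
  ≡mod-cancelʳ {c} {x} {y} m⊥c xc≡yc = ≡mod-cancelˡ m⊥c (subst₂ _≡_[mod m ] (*-comm x c) (*-comm y c) xc≡yc)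

≡mod-∣ : ∀ {d m x y} .{{_ : NonZero d}} .{{_ : NonZero m}} → d ∣ m → x ≡ y [mod m ] → x ≡ y [mod d ]
≡mod-∣ {d} {m} {x} {y} d∣m e = %≡⇒≡mod (begin
    x % d       ≡⟨ m∣n⇒o%n%m≡o%m d m x d∣m ⟨
    x % m % d   ≡⟨ cong (_% d) (≡mod⇒%≡ e) ⟩
    y % m % d   ≡⟨ m∣n⇒o%n%m≡o%m d m y d∣m ⟩
    y % d       ∎)
  where open ≡-Reasoning

coprime-* : ∀ {m a b} → Coprime m a → Coprime m b → Coprime m (a * b)
coprime-* {m} {a} {b} m⊥a m⊥b {d} (d∣m , d∣ab) = m⊥b (d∣m , coprime-divisor d⊥a d∣ab)
  where
  d⊥a : Coprime d a
  d⊥a (e∣d , e∣a) = m⊥a (∣-trans e∣d d∣m , e∣a)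

coprime-^ʳ : ∀ {m a} e → Coprime m a → Coprime m (a ^ e)
coprime-^ʳ {m} zero    _   = Coprime.sym (1-coprimeTo m)
coprime-^ʳ     (suc e) m⊥a = coprime-* m⊥a (coprime-^ʳ e m⊥a)

coprime-^ˡ : ∀ {m a} e → Coprime m a → Coprime (m ^ e) a
coprime-^ˡ e m⊥a = Coprime.sym (coprime-^ʳ e (Coprime.sym m⊥a))

coprime-∣ : ∀ {m n a b} → a ∣ m → b ∣ n → Coprime m n → Coprime a b
coprime-∣ a∣m b∣n m⊥n (d∣a , d∣b) = m⊥n (∣-trans d∣a a∣m , ∣-trans d∣b b∣n)

prime∤⇒coprime : ∀ {p y} → Prime p → ¬ (p ∣ y) → Coprime p y
prime∤⇒coprime pp p∤y {d} (d∣p , d∣y) with prime⇒irreducible pp d∣p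
... | inj₁ d≡1  = d≡1
... | inj₂ refl = contradiction d∣y p∤y

prime≢1 : ∀ {p} → Prime p → p ≢ 1
prime≢1 pp = nonTrivial⇒≢1 {{prime⇒nonTrivial pp}}

coprime-prime-powers : ∀ {p q} α β → Prime p → Prime q → p ≢ q → Coprime (p ^ α) (q ^ β)
coprime-prime-powers {p} {q} α β pp pq p≢q = coprime-^ˡ α (coprime-^ʳ β (prime∤⇒coprime pp p∤q))
  where
  p∤q : ¬ (p ∣ q)
  p∤q p∣q with prime⇒irreducible pq p∣q
  ... | inj₁ p≡1 = prime≢1 pp p≡1
  ... | inj₂ p≡q = p≢q p≡q

-- For p ∣ y the factor y^(m-1) - 1 of y^m - y is prime to p, so p^α divides y.
prime-power-∣⊎coprime : ∀ {p y} α m (pp : Prime p) → 2 ≤ m →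
  let instance _ = m^n≢0 p α {{prime⇒nonZero pp}} in
  y ^ m ≡ y [mod p ^ α ] → p ^ α ∣ y ⊎ Coprime (p ^ α) y
prime-power-∣⊎coprime {p} {zero} α _ _ _ _ = inj₁ ((p ^ α) ∣0)
prime-power-∣⊎coprime {p} {y@(suc _)} α (suc (suc m′)) pp (s≤s (s≤s z≤n)) yᵐ≡y with p ∣? y
... | no p∤y  = inj₂ (coprime-^ˡ α (prime∤⇒coprime pp p∤y))
... | yes p∣y = inj₁ (coprime-divisor pᵅ⊥w∸1 pᵅ∣[w∸1]y)
  where
  instance _ = m^n≢0 p α {{prime⇒nonZero pp}}
  w = y ^ suc m′
  1≤w : 1 ≤ w
  1≤w = m^n>0 y (suc m′)
  y≤yw : y ≤ y * w
  y≤yw = subst (_≤ y * w) (*-identityʳ y) (*-monoʳ-≤ y 1≤w)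
  yw∸y≡[w∸1]y : y * w ∸ y ≡ (w ∸ 1) * y
  yw∸y≡[w∸1]y = trans (cong (y * w ∸_) (sym (*-identityʳ y)))
                      (trans (sym (*-distribˡ-∸ y w 1)) (*-comm y (w ∸ 1)))
  pᵅ∣[w∸1]y : p ^ α ∣ (w ∸ 1) * y
  pᵅ∣[w∸1]y = subst (p ^ α ∣_) yw∸y≡[w∸1]y (≡mod⇒∣∸ y≤yw (≡mod-sym yᵐ≡y))
  p∤w∸1 : ¬ (p ∣ w ∸ 1)
  p∤w∸1 p∣w∸1 = prime≢1 pp (∣1⇒≡1 (∣m+n∣m⇒∣n p∣[w∸1]+1 p∣w∸1))
    where
    p∣[w∸1]+1 : p ∣ (w ∸ 1) + 1
    p∣[w∸1]+1 = subst (p ∣_) (sym (trans (+-comm (w ∸ 1) 1) (m+[n∸m]≡n 1≤w))) (∣m⇒∣m*n (y ^ m′) p∣y)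
  pᵅ⊥w∸1 : Coprime (p ^ α) (w ∸ 1)
  pᵅ⊥w∸1 = coprime-^ˡ α (prime∤⇒coprime pp p∤w∸1)

unique-⊆-length⇒↭ : ∀ {A : Set} {xs ys : List A} → Unique xs → (∀ {x} → x ∈ xs → x ∈ ys) →
                    length xs ≡ length ys → xs ↭ ys
unique-⊆-length⇒↭ {xs = []} {[]} _ _ _ = ↭-refl
unique-⊆-length⇒↭ {xs = x ∷ xs} (x∉xs ∷ xs!) xs⊆ys |xs|≡|ys| with ∈-∃++ (xs⊆ys (here refl))
... | as , bs , refl = ↭-trans (prep x xs↭as++bs) (↭-sym (shift x as bs))
  where
  xs⊆as++bs : ∀ {z} → z ∈ xs → z ∈ as ++ bs
  xs⊆as++bs {z} z∈xs with ∈-++⁻ as (xs⊆ys (there z∈xs))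
  ... | inj₁ z∈as          = ∈-++⁺ˡ z∈as
  ... | inj₂ (here refl)   = contradiction refl (All.lookup x∉xs z∈xs)
  ... | inj₂ (there z∈bs)  = ∈-++⁺ʳ as z∈bs
  |xs|≡|as++bs| : length xs ≡ length (as ++ bs)
  |xs|≡|as++bs| = suc-injective (begin
    suc (length xs)             ≡⟨ |xs|≡|ys| ⟩
    length (as ++ x ∷ bs)       ≡⟨ length-++ as ⟩
    length as + suc (length bs) ≡⟨ +-suc (length as) (length bs) ⟩
    suc (length as + length bs) ≡⟨ cong suc (length-++ as) ⟨
    suc (length (as ++ bs))     ∎)
    where open ≡-Reasoning
  xs↭as++bs : xs ↭ as ++ bs
  xs↭as++bs = unique-⊆-length⇒↭ xs! xs⊆as++bs |xs|≡|as++bs|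

unique-map⁺ : ∀ {A B : Set} (f : A → B) {xs} → (∀ {x y} → x ∈ xs → y ∈ xs → f x ≡ f y → x ≡ y) →
              Unique xs → Unique (map f xs)
unique-map⁺ f {[]}     _   []          = []
unique-map⁺ f {x ∷ xs} inj (x∉xs ∷ xs!) =
  All-map⁺ (All.tabulate λ y∈xs fx≡fy → All.lookup x∉xs y∈xs (inj (here refl) (there y∈xs) fx≡fy))
  ∷ unique-map⁺ f (λ x∈ y∈ → inj (there x∈) (there y∈)) xs!

reducedResidues : ℕ → List ℕ
reducedResidues m = filter (λ i → gcd i m ≟ 1) (map suc (upTo m))

∈-reducedResidues⁻ : ∀ {m u} → u ∈ reducedResidues m → Coprime u m × 1 ≤ u × u ≤ m
∈-reducedResidues⁻ {m} u∈ with ∈-filter⁻ (λ i → gcd i m ≟ 1) {xs = map suc (upTo m)} u∈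
... | u∈suc[upTo] , gcd≡1 with ∈-map⁻ suc u∈suc[upTo]
...   | _ , v∈upTo , refl = gcd≡1⇒coprime gcd≡1 , s≤s z≤n , ∈-upTo⁻ v∈upTo

∈-reducedResidues⁺ : ∀ {m u} → Coprime u m → 1 ≤ u → u ≤ m → u ∈ reducedResidues m
∈-reducedResidues⁺ {m} {suc v} u⊥m _ u≤m =
  ∈-filter⁺ (λ i → gcd i m ≟ 1) (∈-map⁺ suc (∈-upTo⁺ u≤m)) (coprime⇒gcd≡1 u⊥m)

reducedResidues-unique : ∀ m → Unique (reducedResidues m)
reducedResidues-unique m = Unique.filter⁺ (λ i → gcd i m ≟ 1) (Unique.map⁺ suc-injective (Unique.upTo⁺ m))

coprime-product : ∀ {m} xs → (∀ {x} → x ∈ xs → Coprime m x) → Coprime m (product xs)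
coprime-product {m} []       _  = Coprime.sym (1-coprimeTo m)
coprime-product     (x ∷ xs) m⊥ = coprime-* (m⊥ (here refl)) (coprime-product xs (m⊥ ∘ there))

-- Multiplication by b permutes the reduced residues modulo m.
euler : ∀ m b .{{_ : NonZero m}} → Coprime b m → b ^ φ m ≡ 1 [mod m ]
euler 1 b _ = %≡⇒≡mod (trans (n%1≡0 (b ^ φ 1)) (sym (n%1≡0 1)))
euler m@(suc (suc _)) b b⊥m = ≡mod-cancelʳ m⊥∏R bᵠ∏R≡∏R
  where
  R = reducedResidues m
  b· : ℕ → ℕ
  b· u = (b * u) % m
  m⊥∏R : Coprime m (product R)
  m⊥∏R = coprime-product R (λ u∈R → Coprime.sym (proj₁ (∈-reducedResidues⁻ u∈R)))
  residue-< : ∀ {u} → u ∈ R → u < m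
  residue-< u∈R with ∈-reducedResidues⁻ u∈R
  ... | u⊥m , _ , u≤m = ≤∧≢⇒< u≤m λ u≡m →
    contradiction (subst (λ z → Coprime z m) u≡m u⊥m (∣-refl , ∣-refl)) λ ()
  b·-closed : ∀ {u} → u ∈ R → b· u ∈ R
  b·-closed {u} u∈R = ∈-reducedResidues⁺ b·u⊥m (n≢0⇒n>0 b·u≢0) (<⇒≤ (m%n<n (b * u) m))
    where
    b·u⊥m : Coprime (b· u) m
    b·u⊥m (d∣b·u , d∣m) = coprime-* (Coprime.sym b⊥m) (Coprime.sym (proj₁ (∈-reducedResidues⁻ u∈R)))
                                    (d∣m , ∣n∣m%n⇒∣m d∣m d∣b·u)
    b·u≢0 : b· u ≢ 0
    b·u≢0 b·u≡0 = contradiction (0-coprimeTo-m⇒m≡1 (subst (λ z → Coprime z m) b·u≡0 b·u⊥m)) λ ()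
  b·-injective : ∀ {u v} → u ∈ R → v ∈ R → b· u ≡ b· v → u ≡ v
  b·-injective {u} {v} u∈R v∈R e = ≡mod-residue (residue-< u∈R) (residue-< v∈R)
    (≡mod-cancelˡ (Coprime.sym b⊥m) (%≡⇒≡mod e))
  b·R↭R : map b· R ↭ R
  b·R↭R = unique-⊆-length⇒↭ (unique-map⁺ b· b·-injective (reducedResidues-unique m)) b·R⊆R (length-map b· R)
    where
    b·R⊆R : ∀ {v} → v ∈ map b· R → v ∈ R
    b·R⊆R v∈b·R with ∈-map⁻ b· v∈b·R
    ... | u , u∈R , refl = b·-closed u∈R
  ∏b·≡bˡ∏ : ∀ xs → product (map b· xs) ≡ b ^ length xs * product xs [mod m ]
  ∏b·≡bˡ∏ []       = ≡mod-refl
  ∏b·≡bˡ∏ (x ∷ xs) = ≡mod-trans (*-cong-≡mod (%≡⇒≡mod {x = b· x} {b * x} (m%n%n≡m%n (b * x) m)) (∏b·≡bˡ∏ xs))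
                                (≡⇒≡mod (rearrange b x (b ^ length xs) (product xs)))
    where
    rearrange : ∀ b x l p → (b * x) * (l * p) ≡ (b * l) * (x * p)
    rearrange = solve-∀
  bᵠ∏R≡∏R : b ^ φ m * product R ≡ 1 * product R [mod m ]
  bᵠ∏R≡∏R = ≡mod-trans (≡mod-sym (∏b·≡bˡ∏ R)) (≡⇒≡mod (trans (product-↭ b·R↭R) (sym (*-identityˡ (product R)))))

∏-cong : ∀ k {f g : Fin k → ℕ} → (∀ i → f i ≡ g i) → ∏ k f ≡ ∏ k g
∏-cong zero    f≗g = refl
∏-cong (suc k) f≗g = cong₂ _*_ (f≗g Fin.zero) (∏-cong k (f≗g ∘ Fin.suc))

∏-distrib-* : ∀ k (f g : Fin k → ℕ) → ∏ k (λ i → f i * g i) ≡ ∏ k f * ∏ k g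
∏-distrib-* zero    f g = refl
∏-distrib-* (suc k) f g = trans (cong (f Fin.zero * g Fin.zero *_) (∏-distrib-* k (f ∘ Fin.suc) (g ∘ Fin.suc)))
                                (interchange (f Fin.zero) (g Fin.zero) (∏ k (f ∘ Fin.suc)) (∏ k (g ∘ Fin.suc)))
  where
  interchange : ∀ a b c d → (a * b) * (c * d) ≡ (a * c) * (b * d)
  interchange = solve-∀

factor∣∏ : ∀ k (f : Fin k → ℕ) i → f i ∣ ∏ k f
factor∣∏ (suc k) f Fin.zero    = ∣m⇒∣m*n _ ∣-refl
factor∣∏ (suc k) f (Fin.suc i) = ∣n⇒∣m*n (f Fin.zero) (factor∣∏ k (f ∘ Fin.suc) i)

coprime-∏ : ∀ {m} k (f : Fin k → ℕ) → (∀ i → Coprime m (f i)) → Coprime m (∏ k f)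
coprime-∏ {m} zero    f m⊥f = Coprime.sym (1-coprimeTo m)
coprime-∏     (suc k) f m⊥f = coprime-* (m⊥f Fin.zero) (coprime-∏ k (f ∘ Fin.suc) (m⊥f ∘ Fin.suc))

∏-nonZero : ∀ k (f : Fin k → ℕ) → (∀ i → NonZero (f i)) → NonZero (∏ k f)
∏-nonZero zero    f nz = _
∏-nonZero (suc k) f nz = m*n≢0 (f Fin.zero) (∏ k (f ∘ Fin.suc)) {{nz Fin.zero}} {{∏-nonZero k (f ∘ Fin.suc) (nz ∘ Fin.suc)}}

PairwiseCoprime : ∀ {k} → (Fin k → ℕ) → Set
PairwiseCoprime Q = ∀ i j → i ≢ j → Coprime (Q i) (Q j)

coprime-∣⇒*∣ : ∀ {a b d} → Coprime a b → a ∣ d → b ∣ d → a * b ∣ d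
coprime-∣⇒*∣ {a} {b} a⊥b (divides e refl) b∣ea =
  subst (a * b ∣_) (*-comm a e) (*-monoʳ-∣ a (coprime-divisor (Coprime.sym a⊥b) (subst (b ∣_) (*-comm e a) b∣ea)))

pairwiseCoprime-∣⇒∏∣ : ∀ k (Q : Fin k → ℕ) {d} → PairwiseCoprime Q → (∀ i → Q i ∣ d) → ∏ k Q ∣ d
pairwiseCoprime-∣⇒∏∣ zero    Q {d} _   _   = 1∣ d
pairwiseCoprime-∣⇒∏∣ (suc k) Q     Q⊥ Q∣d = coprime-∣⇒*∣ Q₀⊥∏ (Q∣d Fin.zero)
  (pairwiseCoprime-∣⇒∏∣ k (Q ∘ Fin.suc) (λ i j i≢j → Q⊥ (Fin.suc i) (Fin.suc j) (i≢j ∘ Fin.suc-injective)) (Q∣d ∘ Fin.suc))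
  where
  Q₀⊥∏ : Coprime (Q Fin.zero) (∏ k (Q ∘ Fin.suc))
  Q₀⊥∏ = coprime-∏ k (Q ∘ Fin.suc) (λ j → Q⊥ Fin.zero (Fin.suc j) λ ())

chinese-remainder : ∀ k (Q : Fin k → ℕ) (nz : ∀ i → NonZero (Q i)) → PairwiseCoprime Q → ∀ {x y} →
  let instance _ = ∏-nonZero k Q nz in
  (∀ i → let instance _ = nz i in x ≡ y [mod Q i ]) → x ≡ y [mod ∏ k Q ]
chinese-remainder k Q nz Q⊥ {x} {y} x≡y with ≤-total x y
... | inj₁ x≤y = ∣∸⇒≡mod x≤y (pairwiseCoprime-∣⇒∏∣ k Q Q⊥ λ i → let instance _ = nz i in ≡mod⇒∣∸ x≤y (x≡y i))
  where instance _ = ∏-nonZero k Q nz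
... | inj₂ y≤x = ≡mod-sym (∣∸⇒≡mod y≤x (pairwiseCoprime-∣⇒∏∣ k Q Q⊥ λ i → let instance _ = nz i in ≡mod⇒∣∸ y≤x (≡mod-sym (x≡y i))))
  where instance _ = ∏-nonZero k Q nz

∈⇒length-positive : ∀ {A : Set} {x : A} {xs} → x ∈ xs → 1 ≤ length xs
∈⇒length-positive (here _)  = s≤s z≤n
∈⇒length-positive (there _) = s≤s z≤n

φ-positive : ∀ m .{{_ : NonZero m}} → 1 ≤ φ m
φ-positive m = ∈⇒length-positive (∈-reducedResidues⁺ (1-coprimeTo m) ≤-refl (>-nonZero⁻¹ m))

div-exact : ∀ b c .{{_ : NonZero b}} → (b * c) div b ≡ c
div-exact (suc b) c = trans (cong (_/ suc b) (*-comm (suc b) c)) (m*n/n≡m c (suc b))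

unless : {A : Set} → Dec A → ℕ → ℕ
unless (yes _) _ = 1
unless (no _)  r = r

when : {A : Set} → Dec A → ℕ → ℕ
when (yes _) r = r
when (no _)  _ = 1

module _ {A : Set} where

  unless*when : ∀ (d : Dec A) r → unless d r * when d r ≡ r
  unless*when (yes _) r = *-identityˡ r
  unless*when (no _)  r = *-identityʳ r

  unless∣ : ∀ (d : Dec A) r → unless d r ∣ r
  unless∣ (yes _) r = 1∣ r
  unless∣ (no _)  r = ∣-refl

  when∣ : ∀ (d : Dec A) r → when d r ∣ r
  when∣ (yes _) r = ∣-refl
  when∣ (no _)  r = 1∣ r

  coprime-unless-when : ∀ (d : Dec A) r → Coprime (unless d r) (when d r)
  coprime-unless-when (yes _) r = 1-coprimeTo r
  coprime-unless-when (no _)  r = Coprime.sym (1-coprimeTo r)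

bOf≡∏unless : ∀ k (q : Fin k → ℕ) a → bOf k q a ≡ ∏ k (λ j → unless (a mod q j ≟ 1 mod q j) (q j))
bOf≡∏unless zero    q a = refl
bOf≡∏unless (suc k) q a with a mod q Fin.zero ≟ 1 mod q Fin.zero
... | yes _ = cong (1 *_)          (bOf≡∏unless k (q ∘ Fin.suc) a)
... | no _  = cong (q Fin.zero *_) (bOf≡∏unless k (q ∘ Fin.suc) a)

module CoprimeSplitting {k} (Q : Fin k → ℕ) (nz : ∀ i → NonZero (Q i)) (Q⊥ : PairwiseCoprime Q)
                        {S : Fin k → Set} (S? : ∀ i → Dec (S i)) where

  instance
    Q-nonZero : ∀ {i} → NonZero (Q i)
    Q-nonZero = nz _

  b c : ℕ
  b = ∏ k (λ i → unless (S? i) (Q i))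
  c = ∏ k (λ i → when (S? i) (Q i))

  b*c≡∏Q : b * c ≡ ∏ k Q
  b*c≡∏Q = trans (sym (∏-distrib-* k _ _)) (∏-cong k λ i → unless*when (S? i) (Q i))

  instance
    b-nonZero : NonZero b
    b-nonZero = ∏-nonZero k _ λ i → ≢-nonZero λ e → ≢-nonZero⁻¹ (Q i) (0∣⇒≡0 (subst (_∣ Q i) e (unless∣ (S? i) (Q i))))

    c-nonZero : NonZero c
    c-nonZero = ∏-nonZero k _ λ i → ≢-nonZero λ e → ≢-nonZero⁻¹ (Q i) (0∣⇒≡0 (subst (_∣ Q i) e (when∣ (S? i) (Q i))))

  b⊥c : Coprime b c
  b⊥c = coprime-∏ k _ λ j → Coprime.sym (coprime-∏ k _ λ i → Coprime.sym (factors⊥ i j))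
    where
    factors⊥ : ∀ i j → Coprime (unless (S? i) (Q i)) (when (S? j) (Q j))
    factors⊥ i j with i Fin.≟ j
    ... | yes refl = coprime-unless-when (S? i) (Q i)
    ... | no i≢j   = coprime-∣ (unless∣ (S? i) (Q i)) (when∣ (S? j) (Q j)) (Q⊥ i j i≢j)

  Q∣c : ∀ {i} → S i → Q i ∣ c
  Q∣c {i} s with S? i | factor∣∏ k (λ j → when (S? j) (Q j)) i
  ... | yes _ | Q∣c′ = Q∣c′
  ... | no ¬s | _    = contradiction s ¬s

  Q∣b : ∀ {i} → ¬ S i → Q i ∣ b
  Q∣b {i} ¬s with S? i | factor∣∏ k (λ j → unless (S? j) (Q j)) i
  ... | yes s | _    = contradiction s ¬s
  ... | no _  | Q∣b′ = Q∣b′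

  bᵠᶜ≡1 : ∀ {i} → S i → b ^ φ c ≡ 1 [mod Q i ]
  bᵠᶜ≡1 s = ≡mod-∣ (Q∣c s) (euler c b b⊥c)

  bᵠᶜ≡0 : ∀ {i} → ¬ S i → b ^ φ c ≡ 0 [mod Q i ]
  bᵠᶜ≡0 ¬s = ∣⇒≡0mod (∣-trans (Q∣b ¬s) (b∣bᵉ (φ c) (φ-positive c)))
    where
    b∣bᵉ : ∀ e → 1 ≤ e → b ∣ b ^ e
    b∣bᵉ (suc e) _ = ∣m⇒∣m*n (b ^ e) ∣-refl

module _ {n : ℕ} .{{_ : NonZero n}} where

  ≼-antisym : ∀ {y z} → y < n → z < n → y ≼[ n ] z → z ≼[ n ] y → y ≡ z
  ≼-antisym _ _ (inj₁ y≡z) _          = y≡z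
  ≼-antisym _ _ (inj₂ _)   (inj₁ z≡y) = sym z≡y
  ≼-antisym {y} {z} y<n z<n (inj₂ y≡yz) (inj₂ z≡zy) =
    ≡mod-residue y<n z<n (≡mod-trans (mk≡mod y≡yz) (≡mod-trans (≡⇒≡mod (*-comm y z)) (mk≡mod (sym z≡zy))))

  idempotent⇒GP : ∀ {t} → t * t ≡ t [mod n ] → GP n t
  idempotent⇒GP {t} t²≡t = 2 , s≤s (s≤s z≤n) , ≡mod⇒mod≡ (≡mod-trans (≡⇒≡mod (cong (t *_) (*-identityʳ t))) t²≡t)

  greatest-below⇒lowerCover⇔ : ∀ {a t} → t < n → GP n t → t ≺[ n ] a →
    (∀ y → GP n y → y ≺[ n ] a → y ≼[ n ] t) → ∀ x → LowerCoverGP n x a ⇔ x ≡ t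
  greatest-below⇒lowerCover⇔ {a} {t} t<n GPt t≺a below x = mk⇔ to from
    where
    to : LowerCoverGP n x a → x ≡ t
    to (_ , GPx , x≺a , covers) with x ≟ t
    ... | yes x≡t = x≡t
    ... | no x≢t  = contradiction t≺a (covers t t<n GPt (below x GPx x≺a , x≢t))
    from : x ≡ t → LowerCoverGP n x a
    from refl = t<n , GPt , t≺a , λ y y<n GPy (t≼y , t≢y) y≺a → t≢y (≼-antisym t<n y<n t≼y (below y GPy y≺a))

module PrimePowerSplitting {k} (p α : Fin k → ℕ) (prime : ∀ i → Prime (p i)) (p-injective : Injective _≡_ _≡_ p)
                           (a : ℕ) where

  Q : Fin k → ℕ
  Q i = p i ^ α i

  prime-powers-nonZero : ∀ i → NonZero (Q i)
  prime-powers-nonZero i = m^n≢0 (p i) (α i) {{prime⇒nonZero (prime i)}}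

  Q⊥ : PairwiseCoprime Q
  Q⊥ i j i≢j = coprime-prime-powers (α i) (α j) (prime i) (prime j) (i≢j ∘ p-injective)

  open CoprimeSplitting Q prime-powers-nonZero Q⊥ (λ i → a mod Q i ≟ 1 mod Q i) public

  n : ℕ
  n = ∏ k Q

  instance
    n-nonZero : NonZero n
    n-nonZero = ∏-nonZero k Q prime-powers-nonZero

  ≡mod-components : ∀ {x y} → (∀ i → x ≡ y [mod Q i ]) → x ≡ y [mod n ]
  ≡mod-components = chinese-remainder k Q prime-powers-nonZero Q⊥

  ≡mod-component : ∀ {x y} i → x ≡ y [mod n ] → x ≡ y [mod Q i ]
  ≡mod-component i = ≡mod-∣ (factor∣∏ k Q i)

  t : ℕ
  t = (b ^ φ c) mod n

  t≡bᵠᶜ : ∀ {i} → t ≡ b ^ φ c [mod Q i ]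
  t≡bᵠᶜ {i} = ≡mod-component i (mod-≡mod (b ^ φ c))

  Component : Fin k → Set
  Component i = (a ≡ 1 [mod Q i ] × t ≡ 1 [mod Q i ]) ⊎ (¬ a ≡ 1 [mod Q i ] × t ≡ 0 [mod Q i ])

  t-component : ∀ i → Component i
  t-component i with a mod Q i ≟ 1 mod Q i
  ... | yes a≡1 = inj₁ (mk≡mod a≡1 , ≡mod-trans t≡bᵠᶜ (bᵠᶜ≡1 a≡1))
  ... | no a≢1  = inj₂ (a≢1 ∘ ≡mod⇒mod≡ , ≡mod-trans t≡bᵠᶜ (bᵠᶜ≡0 a≢1))

  t-idempotent : t * t ≡ t [mod n ]
  t-idempotent = ≡mod-components λ i → ≡mod-sym (t≡t² (t-component i))
    where
    t≡t² : ∀ {i} → Component i → t ≡ t * t [mod Q i ]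
    t≡t² (inj₁ (_ , t≡1)) = ≡1-neutral t≡1
    t≡t² (inj₂ (_ , t≡0)) = ≡0-absorbs t≡0

  t≼a : t ≼[ n ] a
  t≼a = inj₂ (≡mod⇒mod≡ (≡mod-components λ i → t≡ta (t-component i)))
    where
    t≡ta : ∀ {i} → Component i → t ≡ t * a [mod Q i ]
    t≡ta (inj₁ (a≡1 , _)) = ≡1-neutral a≡1
    t≡ta (inj₂ (_ , t≡0)) = ≡0-absorbs t≡0

  t≢a : ¬ P n a → t ≢ a
  t≢a ¬Pa t≡a = ¬Pa (subst (P n) t≡a (≡mod⇒mod≡ t-idempotent))

  GP⇒∣⊎coprime : ∀ {y} → GP n y → ∀ i → Q i ∣ y ⊎ Coprime (Q i) y
  GP⇒∣⊎coprime (m , 2≤m , yᵐ≡y) i = prime-power-∣⊎coprime (α i) m (prime i) 2≤m (≡mod-component i (mk≡mod yᵐ≡y))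

  below-a⇒≼t : ∀ y → GP n y → y ≺[ n ] a → y ≼[ n ] t
  below-a⇒≼t y _   (inj₁ y≡a , y≢a) = contradiction y≡a y≢a
  below-a⇒≼t y GPy (inj₂ y≡ya , _)  = inj₂ (≡mod⇒mod≡ (≡mod-components λ i → y≡yt (GP⇒∣⊎coprime GPy i) (t-component i)))
    where
    y≡yt : ∀ {i} → Q i ∣ y ⊎ Coprime (Q i) y → Component i → y ≡ y * t [mod Q i ]
    y≡yt (inj₁ Q∣y)     _                 = ≡0-absorbs (∣⇒≡0mod Q∣y)
    y≡yt (inj₂ _)       (inj₁ (_ , t≡1))  = ≡1-neutral t≡1
    y≡yt {i} (inj₂ Q⊥y) (inj₂ (a≢1 , _)) = contradiction (≡mod-sym a≡1) a≢1
      where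
      a≡1 : 1 ≡ a [mod Q i ]
      a≡1 = ≡mod-cancelˡ Q⊥y (≡mod-trans (≡⇒≡mod (*-identityʳ y)) (≡mod-component i (mk≡mod y≡ya)))

  t-formula : (bOf k Q a ^ φ (n div bOf k Q a)) mod n ≡ t
  t-formula = begin
    (bOf k Q a ^ φ (n div bOf k Q a)) mod n  ≡⟨ cong (λ B → (B ^ φ (n div B)) mod n) (bOf≡∏unless k Q a) ⟩
    (b ^ φ (n div b)) mod n                  ≡⟨ cong (λ m → (b ^ φ (m div b)) mod n) (sym b*c≡∏Q) ⟩
    (b ^ φ ((b * c) div b)) mod n            ≡⟨ cong (λ C → (b ^ φ C) mod n) (div-exact b c) ⟩
    t                                        ∎
    where open ≡-Reasoning

theorem2p5 : (n : ℕ) → 1 < n →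
    (k : ℕ) (p α : Fin k → ℕ) →
    (∀ i → Prime (p i)) → Injective _≡_ _≡_ p → (∀ i → 0 < α i) →
    n ≡ ∏ k (λ i → p i ^ α i) →
    (a : ℕ) → a < n → GP n a → ¬ P n a →
    let b = bOf k (λ i → p i ^ α i) a in
    (x : ℕ) → x < n →
    (LowerCoverGP n x a ⇔ x ≡ (b ^ φ (n div b)) mod n)
theorem2p5 _ _ k p α prime p-injective _ refl a _ _ ¬Pa x _ =
  subst (λ t′ → LowerCoverGP n x a ⇔ x ≡ t′) (sym t-formula)
    (greatest-below⇒lowerCover⇔ (mod-< (b ^ φ c)) (idempotent⇒GP t-idempotent) (t≼a , t≢a ¬Pa) below-a⇒≼t x)
  where open PrimePowerSplitting p α prime p-injective a
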